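{- Let $C$ be any cycle in the grid graph $G(m,n)$. Then every row and every column of the grid contains an even number of turns of $C$.
   Context: $G(m,n)$ is the graph on cells $\{1,\dots,m\}\times\{1,\dots,n\}$ with $(a,b),(c,d)$ adjacent iff $|a-c|+|b-d|=1$. A row is the set of cells with a fixed second coordinate; a column is the set of cells with a fixed first coordinate. A turn of a cycle is a cell of the cycle whose two incident cycle edges are one horizontal (within a row) and one vertical (within a column). -}

module Defs where

open import Data.Nat using (ℕ; zero; suc; _+_; _≤_; ∣_-_∣)
open import Data.Nat.DivMod using (_mod_)
open import Data.Fin using (Fin; toℕ)
open import Data.Fin.Properties using () renaming (_≟_ to _≟ᶠ_)
open import Data.Bool using (Bool; true; false; _∧_; _∨_; if_then_else_)
open import Data.Product using (_×_; _,_; proj₁; proj₂)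
open import Function.Definitions using (Injective)
open import Relation.Binary.PropositionalEquality using (_≡_)
open import Relation.Nullary.Decidable using (⌊_⌋)

-- A cell (a , b) of G(m,n): a ∈ {1..m} (column index / first coordinate),
-- b ∈ {1..n} (second coordinate), encoded 0-based by Fin.
Cell : ℕ → ℕ → Set
Cell m n = Fin m × Fin n

Adjacent : ∀ {m n} → Cell m n → Cell m n → Set
Adjacent (a , b) (c , d) = ∣ toℕ a - toℕ c ∣ + ∣ toℕ b - toℕ d ∣ ≡ 1

next : ∀ {l} → Fin (suc l) → Fin (suc l)
next {l} i = suc (toℕ i) mod suc l

prev : ∀ {l} → Fin (suc l) → Fin (suc l)
prev {l} i = (toℕ i + l) mod suc l

record Cycle (m n : ℕ) : Set where
  field
    l      : ℕ
    long   : 2 ≤ l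
    v      : Fin (suc l) → Cell m n
    inj    : Injective _≡_ _≡_ v
    adj    : ∀ i → Adjacent (v i) (v (next i))

horizontalᵇ : ∀ {m n} → Cell m n → Cell m n → Bool
horizontalᵇ (a , b) (c , d) = ⌊ b ≟ᶠ d ⌋

verticalᵇ : ∀ {m n} → Cell m n → Cell m n → Bool
verticalᵇ (a , b) (c , d) = ⌊ a ≟ᶠ c ⌋

isTurnᵇ : ∀ {m n} (C : Cycle m n) → Fin (suc (Cycle.l C)) → Bool
isTurnᵇ C i =
  (horizontalᵇ (v (prev i)) (v i) ∧ verticalᵇ (v i) (v (next i)))
  ∨ (verticalᵇ (v (prev i)) (v i) ∧ horizontalᵇ (v i) (v (next i)))
  where open Cycle C

count : (k : ℕ) → (Fin k → Bool) → ℕ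
count zero    p = 0
count (suc k) p = (if p Fin.zero then 1 else 0) + count k (λ i → p (Fin.suc i))

turnsInRow : ∀ {m n} → Cycle m n → Fin n → ℕ
turnsInRow C y = count (suc (Cycle.l C))
  (λ i → isTurnᵇ C i ∧ ⌊ proj₂ (Cycle.v C i) ≟ᶠ y ⌋)

turnsInColumn : ∀ {m n} → Cycle m n → Fin m → ℕ
turnsInColumn C x = count (suc (Cycle.l C))
  (λ i → isTurnᵇ C i ∧ ⌊ proj₁ (Cycle.v C i) ≟ᶠ x ⌋)

-- Fix a row and mark the positions of the cycle lying in it.  An edge of the cycle is
-- horizontal or vertical but never both, so a marked position is a turn exactly when one
-- of its two cyclic neighbours is marked, i.e. when it ends a maximal run of marked
-- positions.  Writing g for the marking, Σᵢ gᵢ gᵢ₋₁ + Σᵢ gᵢ gᵢ₊₁ counts every run end once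
-- and every interior marked position twice, and the two sums agree after rotating the
-- index; so the number of run ends is even.
module Submission where

open import Defs
open import Algebra.Properties.CommutativeMonoid.Sum as Sum using ()
open import Algebra.Properties.Semiring.Sum as SemiringSum using ()
open import Data.Bool using (Bool; true; false; not; _∧_; _∨_; _xor_; if_then_else_)
open import Data.Bool.Properties using (∧-comm; ∧-zeroʳ; ∧-identityʳ)
open import Data.Fin using (Fin; toℕ)
open import Data.Fin.Permutation using (Permutation′; permutation)
open import Data.Fin.Properties using (toℕ-injective; toℕ-fromℕ<; toℕ<n) renaming (_≟_ to _≟ᶠ_)
open import Data.Nat using (ℕ; NonZero; zero; suc; _+_; _*_; _%_; ∣_-_∣)
open import Data.Nat.Divisibility using (_∣_; m∣m*n; ∣m+n∣m⇒∣n)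
open import Data.Nat.DivMod using (m%n<n; %-distribˡ-+; m%n%n≡m%n; [m+n]%n≡m%n; m<n⇒m%n≡m)
open import Data.Nat.Properties
  using (+-suc; +-comm; +-identityʳ; ∣m-n∣≡0⇒m≡n; ∣n-n∣≡0; +-0-commutativeMonoid; +-*-semiring)
open import Data.Product using (_×_; _,_; proj₁; proj₂)
open import Data.Sum using (_⊎_; inj₁; inj₂)
open import Relation.Binary.PropositionalEquality
open import Relation.Nullary using (yes; no; contradiction)
open import Relation.Nullary.Decidable using (⌊_⌋)

open Sum +-0-commutativeMonoid using (sum-syntax; ∑-distrib-+; ∑-permute; sum-cong-≗)
open SemiringSum +-*-semiring using (*-distribˡ-sum)

[m%n+k]%n≡[m+k]%n : ∀ m k n .{{_ : NonZero n}} → (m % n + k) % n ≡ (m + k) % n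
[m%n+k]%n≡[m+k]%n m k n = begin
  (m % n + k) % n          ≡⟨ %-distribˡ-+ (m % n) k n ⟩
  (m % n % n + k % n) % n  ≡⟨ cong (λ x → (x + k % n) % n) (m%n%n≡m%n m n) ⟩
  (m % n + k % n) % n      ≡⟨ %-distribˡ-+ m k n ⟨
  (m + k) % n              ∎
  where open ≡-Reasoning

module _ {l : ℕ} where

  private
    N : ℕ
    N = suc l

  prev-next : (i : Fin N) → prev (next i) ≡ i
  prev-next i = toℕ-injective (begin
    toℕ (prev (next i))     ≡⟨ toℕ-fromℕ< _ ⟩
    (toℕ (next i) + l) % N  ≡⟨ cong (λ x → (x + l) % N) (toℕ-fromℕ< (m%n<n (suc t) N)) ⟩
    (suc t % N + l) % N     ≡⟨ [m%n+k]%n≡[m+k]%n (suc t) l N ⟩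
    (suc t + l) % N         ≡⟨ cong (_% N) (+-suc t l) ⟨
    (t + N) % N             ≡⟨ [m+n]%n≡m%n t N ⟩
    t % N                   ≡⟨ m<n⇒m%n≡m (toℕ<n i) ⟩
    t                       ∎)
    where
    open ≡-Reasoning
    t = toℕ i

  next-prev : (i : Fin N) → next (prev i) ≡ i
  next-prev i = toℕ-injective (begin
    toℕ (next (prev i))      ≡⟨ toℕ-fromℕ< _ ⟩
    suc (toℕ (prev i)) % N   ≡⟨ cong (λ x → suc x % N) (toℕ-fromℕ< (m%n<n (t + l) N)) ⟩
    suc ((t + l) % N) % N    ≡⟨ cong (_% N) (+-comm 1 ((t + l) % N)) ⟩
    ((t + l) % N + 1) % N    ≡⟨ [m%n+k]%n≡[m+k]%n (t + l) 1 N ⟩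
    (t + l + 1) % N          ≡⟨ cong (_% N) (trans (+-comm (t + l) 1) (sym (+-suc t l))) ⟩
    (t + N) % N              ≡⟨ [m+n]%n≡m%n t N ⟩
    t % N                    ≡⟨ m<n⇒m%n≡m (toℕ<n i) ⟩
    t                        ∎)
    where
    open ≡-Reasoning
    t = toℕ i

  rotation : Permutation′ N
  rotation = permutation next prev next-prev prev-next

indicator : Bool → ℕ
indicator b = if b then 1 else 0

count≡∑indicator : ∀ k (p : Fin k → Bool) → count k p ≡ ∑[ i < k ] indicator (p i)
count≡∑indicator zero    p = refl
count≡∑indicator (suc k) p = cong (indicator (p Fin.zero) +_) (count≡∑indicator k (λ i → p (Fin.suc i)))

count-cong : ∀ k {p q : Fin k → Bool} → (∀ i → p i ≡ q i) → count k p ≡ count k q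
count-cong zero    p≗q = refl
count-cong (suc k) p≗q =
  cong₂ _+_ (cong indicator (p≗q Fin.zero)) (count-cong k (λ i → p≗q (Fin.suc i)))

-- i is the first or last position of a maximal cyclic run of g of length at least two.
endOfRun : ∀ {l} → (Fin (suc l) → Bool) → Fin (suc l) → Bool
endOfRun g i = g i ∧ (g (prev i) xor g (next i))

2∣count-endOfRun : ∀ {l} (g : Fin (suc l) → Bool) → 2 ∣ count (suc l) (endOfRun g)
2∣count-endOfRun {l} g =
  ∣m+n∣m⇒∣n (subst (2 ∣_) pairs≡ (m∣m*n (∑[ i < N ] forward i))) (m∣m*n (∑[ i < N ] interior i))
  where
  N = suc l
  backward forward interior ends : Fin N → ℕ
  backward i = indicator (g i ∧ g (prev i))
  forward  i = indicator (g i ∧ g (next i))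
  interior i = indicator (g i ∧ (g (prev i) ∧ g (next i)))
  ends     i = indicator (endOfRun g i)

  split : ∀ a b c → indicator (a ∧ b) + indicator (a ∧ c)
                  ≡ 2 * indicator (a ∧ (b ∧ c)) + indicator (a ∧ (b xor c))
  split false b     c     = refl
  split true  false c     = refl
  split true  true  false = refl
  split true  true  true  = refl

  backward≡forward : ∑[ i < N ] backward i ≡ ∑[ i < N ] forward i
  backward≡forward = trans (∑-permute backward rotation) (sum-cong-≗ λ i →
    cong indicator (trans (cong (g (next i) ∧_) (cong g (prev-next i))) (∧-comm (g (next i)) (g i))))

  pairs≡ : 2 * ∑[ i < N ] forward i ≡ 2 * ∑[ i < N ] interior i + count N (endOfRun g)
  pairs≡ = begin
    2 * ∑[ i < N ] forward i                              ≡⟨ cong (∑[ i < N ] forward i +_) (+-identityʳ _) ⟩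
    ∑[ i < N ] forward i + ∑[ i < N ] forward i            ≡⟨ cong (_+ ∑[ i < N ] forward i) backward≡forward ⟨
    ∑[ i < N ] backward i + ∑[ i < N ] forward i           ≡⟨ ∑-distrib-+ backward forward ⟨
    ∑[ i < N ] (backward i + forward i)                   ≡⟨ sum-cong-≗ (λ i → split (g i) (g (prev i)) (g (next i))) ⟩
    ∑[ i < N ] (2 * interior i + ends i)                  ≡⟨ ∑-distrib-+ (λ i → 2 * interior i) ends ⟩
    ∑[ i < N ] (2 * interior i) + ∑[ i < N ] ends i        ≡⟨ cong₂ _+_ (*-distribˡ-sum 2 interior) (count≡∑indicator N (endOfRun g)) ⟨
    2 * ∑[ i < N ] interior i + count N (endOfRun g)      ∎
    where open ≡-Reasoning

⌊≟⌋-sym : ∀ {k} (x y : Fin k) → ⌊ x ≟ᶠ y ⌋ ≡ ⌊ y ≟ᶠ x ⌋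
⌊≟⌋-sym x y with x ≟ᶠ y | y ≟ᶠ x
... | yes _   | yes _   = refl
... | no  _   | no  _   = refl
... | yes x≡y | no  y≢x = contradiction (sym x≡y) y≢x
... | no  x≢y | yes y≡x = contradiction (sym y≡x) x≢y

≟-xor-at-level : ∀ {k} (a b c y : Fin k) →
  (⌊ a ≟ᶠ b ⌋ xor ⌊ b ≟ᶠ c ⌋) ∧ ⌊ b ≟ᶠ y ⌋ ≡ ⌊ b ≟ᶠ y ⌋ ∧ (⌊ a ≟ᶠ y ⌋ xor ⌊ c ≟ᶠ y ⌋)
≟-xor-at-level a b c y with b ≟ᶠ y
... | yes refl = trans (∧-identityʳ _) (cong (⌊ a ≟ᶠ b ⌋ xor_) (⌊≟⌋-sym b c))
... | no  _    = ∧-zeroʳ _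

m+n≡1⇒m≡0∨n≡0 : ∀ m n → m + n ≡ 1 → m ≡ 0 ⊎ n ≡ 0
m+n≡1⇒m≡0∨n≡0 zero          n             _  = inj₁ refl
m+n≡1⇒m≡0∨n≡0 (suc m)       zero          _  = inj₂ refl
m+n≡1⇒m≡0∨n≡0 (suc zero)    (suc n)       ()
m+n≡1⇒m≡0∨n≡0 (suc (suc m)) (suc n)       ()

adjacent⇒vertical≡not-horizontal : ∀ {m n} (p q : Cell m n) →
  Adjacent p q → verticalᵇ p q ≡ not (horizontalᵇ p q)
adjacent⇒vertical≡not-horizontal (a , b) (c , d) adj with a ≟ᶠ c | b ≟ᶠ d
... | yes _   | no  _   = refl
... | no  _   | yes _   = refl
... | yes refl | yes refl =
  contradiction (trans (sym (cong₂ _+_ (∣n-n∣≡0 (toℕ a)) (∣n-n∣≡0 (toℕ b)))) adj) λ ()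
... | no  a≢c | no  b≢d with m+n≡1⇒m≡0∨n≡0 ∣ toℕ a - toℕ c ∣ ∣ toℕ b - toℕ d ∣ adj
...   | inj₁ ∣a-c∣≡0 = contradiction (toℕ-injective (∣m-n∣≡0⇒m≡n ∣a-c∣≡0)) a≢c
...   | inj₂ ∣b-d∣≡0 = contradiction (toℕ-injective (∣m-n∣≡0⇒m≡n ∣b-d∣≡0)) b≢d

turn-xor : ∀ h₁ v₁ h₂ v₂ → v₁ ≡ not h₁ → v₂ ≡ not h₂ →
  ((h₁ ∧ v₂) ∨ (v₁ ∧ h₂) ≡ h₁ xor h₂) × ((h₁ ∧ v₂) ∨ (v₁ ∧ h₂) ≡ v₁ xor v₂)
turn-xor false _ false _ refl refl = refl , refl
turn-xor false _ true  _ refl refl = refl , refl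
turn-xor true  _ false _ refl refl = refl , refl
turn-xor true  _ true  _ refl refl = refl , refl

module _ {m n : ℕ} (C : Cycle m n) where
  open Cycle C

  adjacent-prev : ∀ i → Adjacent (v (prev i)) (v i)
  adjacent-prev i = subst (λ j → Adjacent (v (prev i)) (v j)) (next-prev i) (adj (prev i))

  isTurn≡xor : ∀ i →
    (isTurnᵇ C i ≡ horizontalᵇ (v (prev i)) (v i) xor horizontalᵇ (v i) (v (next i)))
    × (isTurnᵇ C i ≡ verticalᵇ (v (prev i)) (v i) xor verticalᵇ (v i) (v (next i)))
  isTurn≡xor i = turn-xor _ _ _ _
    (adjacent⇒vertical≡not-horizontal (v (prev i)) (v i) (adjacent-prev i))
    (adjacent⇒vertical≡not-horizontal (v i) (v (next i)) (adj i))

  inRow : Fin n → Fin (suc l) → Bool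
  inRow y i = ⌊ proj₂ (v i) ≟ᶠ y ⌋

  inColumn : Fin m → Fin (suc l) → Bool
  inColumn x i = ⌊ proj₁ (v i) ≟ᶠ x ⌋

  turnInRow≡endOfRun : ∀ y i → isTurnᵇ C i ∧ inRow y i ≡ endOfRun (inRow y) i
  turnInRow≡endOfRun y i = trans (cong (_∧ _) (proj₁ (isTurn≡xor i)))
    (≟-xor-at-level (proj₂ (v (prev i))) (proj₂ (v i)) (proj₂ (v (next i))) y)

  turnInColumn≡endOfRun : ∀ x i → isTurnᵇ C i ∧ inColumn x i ≡ endOfRun (inColumn x) i
  turnInColumn≡endOfRun x i = trans (cong (_∧ _) (proj₂ (isTurn≡xor i)))
    (≟-xor-at-level (proj₁ (v (prev i))) (proj₁ (v i)) (proj₁ (v (next i))) x)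

lemma3 : (m n : ℕ) (C : Cycle m n) →
    ((y : Fin n) → 2 ∣ turnsInRow C y) × ((x : Fin m) → 2 ∣ turnsInColumn C x)
lemma3 m n C =
    (λ y → subst (2 ∣_) (count-cong N (λ i → sym (turnInRow≡endOfRun C y i)))
                        (2∣count-endOfRun (inRow C y)))
  , (λ x → subst (2 ∣_) (count-cong N (λ i → sym (turnInColumn≡endOfRun C x i)))
                        (2∣count-endOfRun (inColumn C x)))
  where N = suc (Cycle.l C)
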